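{- Let $T$ be a tree of order $n$ and maximum degree $\Delta(T)=k$. Then $\mathrm{rad}(B_{n,k})\leq \mathrm{rad}(T)$, where $B_{n,k}$ denotes any $k$-balanced tree of order $n$.
   Context: All graphs are finite, simple, undirected and connected; $\mathrm{dist}(u,v)$ is the number of edges of a shortest $u$–$v$ path. The eccentricity of a vertex $x$ is $\mathrm{ecc}(x)=\max_{y}\mathrm{dist}(x,y)$ and the radius is $\mathrm{rad}(G)=\min_x \mathrm{ecc}(x)$. A tree $T$ of maximum degree $k$ is called $k$-balanced if there exists a vertex $x$ such that every vertex $z$ with $\mathrm{dist}(z,x)\leq \mathrm{ecc}(x)-2$ satisfies $\deg(z)=k$. The radius of a $k$-balanced tree of order $n$ depends only on $n$ and $k$; $B_{n,k}$ denotes an arbitrary $k$-balanced tree of order $n$. -}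

module Defs where

open import Data.Nat using (ℕ; zero; suc; _+_; _≤_)
open import Data.Fin using (Fin)
open import Data.Bool using (Bool; true; false; T; if_then_else_)
open import Data.List using (List; map; allFin)
open import Data.Nat.ListAction using (sum)
open import Data.Vec using (Vec; lookup)
open import Data.Product using (Σ; ∃; _×_)
open import Relation.Binary.PropositionalEquality using (_≡_; _≢_)
open import Relation.Nullary using (¬_)
open import Function.Definitions using (Injective)

record Graph (n : ℕ) : Set where
  field
    adj   : Fin n → Fin n → Bool
    sym   : ∀ u v → adj u v ≡ adj v u
    irrefl : ∀ u → adj u u ≡ false
open Graph public

Adj : ∀ {n} → Graph n → Fin n → Fin n → Set
Adj G u v = T (adj G u v)

data Walk {n : ℕ} (G : Graph n) : Fin n → Fin n → ℕ → Set where
  [] : ∀ {u} → Walk G u u zero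
  _∷_ : ∀ {u v w l} → Adj G u v → Walk G v w l → Walk G u w (suc l)

Connected : ∀ {n} → Graph n → Set
Connected G = ∀ u v → ∃ λ l → Walk G u v l

record Cycle {n : ℕ} (G : Graph n) : Set where
  field
    m      : ℕ
    verts  : Vec (Fin n) (suc (suc (suc m)))
    distinct : Injective _≡_ _≡_ (lookup verts)
    consec : ∀ (i : Fin (suc (suc m))) →
               Adj G (lookup verts (Data.Fin.inject₁ i)) (lookup verts (Data.Fin.suc i))
    closing : Adj G (lookup verts (Data.Fin.fromℕ (suc (suc m)))) (lookup verts Data.Fin.zero)

Acyclic : ∀ {n} → Graph n → Set
Acyclic G = ¬ Cycle G

IsTree : ∀ {n} → Graph n → Set
IsTree G = Connected G × Acyclic G

deg : ∀ {n} → Graph n → Fin n → ℕ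
deg {n} G v = sum (map (λ w → if adj G v w then 1 else 0) (allFin n))

MaxDegree : ∀ {n} → Graph n → ℕ → Set
MaxDegree G k = (∀ v → deg G v ≤ k) × ∃ λ v → deg G v ≡ k

Dist : ∀ {n} → Graph n → Fin n → Fin n → ℕ → Set
Dist G u v d = Walk G u v d × (∀ l → Walk G u v l → d ≤ l)

Ecc : ∀ {n} → Graph n → Fin n → ℕ → Set
Ecc G x e = (∀ y → ∃ λ d → Dist G x y d × d ≤ e) × ∃ λ y → Dist G x y e

Rad : ∀ {n} → Graph n → ℕ → Set
Rad G r = (∃ λ x → Ecc G x r) × (∀ x e → Ecc G x e → r ≤ e)

KBalanced : ∀ {n} → Graph n → ℕ → Set
KBalanced G k = IsTree G × MaxDegree G k ×
  ∃ λ x → ∃ λ e → Ecc G x e × (∀ z d → Dist G z x d → d + 2 ≤ e → deg G z ≡ k)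

module Submission where

-- Fix a root and sort the vertices into levels by their distance from it.
-- In a graph of maximum degree k the root has at most k neighbours on
-- level 1, and every other vertex on level d has at most k − 1 neighbours
-- on level d + 1, because one of its neighbours lies on level d − 1.
-- Double counting the edges between two consecutive levels therefore gives
-- |level i| ≤ L(i), where L(0) = 1, L(1) = k, L(i + 1) = L(i)·(k − 1).
-- In a tree there are no edges inside a level and every vertex has a unique
-- parent, so if all vertices on the levels 0 … i − 1 have degree exactly k
-- the same double count gives |level i| ≥ L(i).
--
-- Now let c be a centre of T (so every vertex is within rad(T) of c) and
-- let x be the vertex witnessing that B is k-balanced, with eccentricity e.
-- If rad(T) < e, then
--   n ≤ Σ_{i ≤ rad T} L(i) ≤ Σ_{i ≤ e−1} L(i) ≤ Σ_{i ≤ e−1} |level_B i| < n,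
-- the last step because level e of B is non-empty.  Hence e ≤ rad(T), and
-- rad(B) ≤ ecc(x) = e.

open import Defs hiding (sym)
open import Data.Nat using (ℕ; zero; suc; _+_; _*_; _∸_; _≤_; _<_; z≤n; s≤s; s≤s⁻¹; _≡ᵇ_; _≟_)
open import Data.Nat.Properties
open import Data.Fin using (Fin; inject₁; fromℕ; punchIn) renaming (zero to fzero; suc to fsuc)
open import Data.Fin.Properties using (punchInᵢ≢i) renaming (_≟_ to _≟ᶠ_)
open import Data.Bool using (Bool; true; false; T; if_then_else_)
open import Data.Unit using (tt)
open import Data.Empty using (⊥; ⊥-elim)
open import Data.Vec using (Vec; []; _∷_; _∷ʳ_; lookup)
open import Data.Vec.Relation.Unary.All as All using (All; []; _∷_)
open import Data.Vec.Relation.Unary.AllPairs using ([]; _∷_)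
open import Data.Vec.Relation.Unary.Linked using (Linked; [-]; _∷_)
open import Data.Vec.Relation.Unary.Unique.Propositional using (Unique)
open import Data.Vec.Relation.Unary.Unique.Propositional.Properties using (lookup-injective)
open import Data.List using (tabulate)
open import Data.List.Properties using (map-tabulate)
import Data.Nat.ListAction as List
open import Algebra.Properties.Semiring.Sum +-*-semiring
  using (sum; sum-syntax; ∑-distrib-+; ∑-comm; *-distribˡ-sum; *-distribʳ-sum;
         sum-cong-≗; sum-remove; sum-replicate-zero)
open import Data.Sum using (inj₁; inj₂)
open import Data.Product using (Σ; _×_; _,_; proj₁; proj₂)
open import Relation.Binary.PropositionalEquality
open import Relation.Nullary using (¬_; yes; no)
open import Function using (id; _∘_)

bit : Bool → ℕ
bit b = if b then 1 else 0

bit≤1 : ∀ b → bit b ≤ 1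
bit≤1 true  = ≤-refl
bit≤1 false = z≤n

bit-true : ∀ {b} → T b → bit b ≡ 1
bit-true {true} _ = refl

bit-≡ᵇ : ∀ a i → a ≢ i → bit (a ≡ᵇ i) ≡ 0
bit-≡ᵇ a i a≢i with a ≡ᵇ i in eq
... | true  = ⊥-elim (a≢i (≡ᵇ⇒≡ a i (subst T (sym eq) tt)))
... | false = refl

bit-≡ᵇ-refl : ∀ a → bit (a ≡ᵇ a) ≡ 1
bit-≡ᵇ-refl a = bit-true (≡⇒≡ᵇ a a refl)

bit*bit≡0 : ∀ b c → (T b → T c → ⊥) → bit b * bit c ≡ 0
bit*bit≡0 true  true  incompatible = ⊥-elim (incompatible tt tt)
bit*bit≡0 true  false _ = refl
bit*bit≡0 false _     _ = refl

bit*-mono : ∀ b {m m'} → (T b → m ≤ m') → bit b * m ≤ bit b * m'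
bit*-mono true  m≤m' = +-monoˡ-≤ 0 (m≤m' tt)
bit*-mono false _    = z≤n

∑-mono : ∀ {m} {f g : Fin m → ℕ} → (∀ i → f i ≤ g i) → ∑[ i < m ] f i ≤ ∑[ i < m ] g i
∑-mono {zero}  f≤g = z≤n
∑-mono {suc m} f≤g = +-mono-≤ (f≤g fzero) (∑-mono (f≤g ∘ fsuc))

term≤∑ : ∀ {m} (f : Fin m → ℕ) i → f i ≤ ∑[ j < m ] f j
term≤∑ f fzero    = m≤m+n _ _
term≤∑ f (fsuc i) = ≤-trans (term≤∑ (f ∘ fsuc) i) (m≤n+m _ (f fzero))

∑-zero : ∀ {m} (f : Fin m → ℕ) → (∀ i → f i ≡ 0) → ∑[ i < m ] f i ≡ 0
∑-zero {m} f f≡0 = trans (sum-cong-≗ f≡0) (sum-replicate-zero m)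

∑-supported : ∀ {m} (f : Fin m → ℕ) p → (∀ i → i ≢ p → f i ≡ 0) → ∑[ i < m ] f i ≡ f p
∑-supported {suc m} f p off-p = begin
  sum f                        ≡⟨ sum-remove {i = p} f ⟩
  f p + sum (f ∘ punchIn p)    ≡⟨ cong (f p +_) (∑-zero _ (λ i → off-p _ (punchInᵢ≢i p i))) ⟩
  f p + 0                      ≡⟨ +-identityʳ (f p) ⟩
  f p                          ∎
  where open ≡-Reasoning

-- The degree in Defs is a list sum; it agrees with the sum over Fin m.
listSum-tabulate : ∀ {m} (f : Fin m → ℕ) → List.sum (tabulate f) ≡ ∑[ i < m ] f i
listSum-tabulate {zero}  f = refl
listSum-tabulate {suc m} f = cong (f fzero +_) (listSum-tabulate (f ∘ fsuc))

one-of-three : ∀ a d → a ≤ suc d → d ≤ suc a →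
  bit (suc a ≡ᵇ d) + bit (a ≡ᵇ d) + bit (a ≡ᵇ suc d) ≡ 1
one-of-three zero          zero          _     _     = refl
one-of-three zero          (suc zero)    _     _     = refl
one-of-three zero          (suc (suc d)) _     (s≤s ())
one-of-three (suc zero)    zero          _     _     = refl
one-of-three (suc (suc a)) zero          (s≤s ()) _
one-of-three (suc a)       (suc d)       a≤d+1 d≤a+1 = one-of-three a d (s≤s⁻¹ a≤d+1) (s≤s⁻¹ d≤a+1)

rangeSum : ℕ → (ℕ → ℕ) → ℕ
rangeSum zero    g = g 0
rangeSum (suc R) g = rangeSum R g + g (suc R)

rangeSum-mono : ∀ R {g h : ℕ → ℕ} → (∀ i → i ≤ R → g i ≤ h i) → rangeSum R g ≤ rangeSum R h
rangeSum-mono zero    g≤h = g≤h 0 z≤n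
rangeSum-mono (suc R) g≤h =
  +-mono-≤ (rangeSum-mono R (λ i i≤R → g≤h i (m≤n⇒m≤1+n i≤R))) (g≤h (suc R) ≤-refl)

rangeSum-monoʳ : ∀ (g : ℕ → ℕ) {R R'} → R ≤ R' → rangeSum R g ≤ rangeSum R' g
rangeSum-monoʳ g {R' = zero}   z≤n = ≤-refl
rangeSum-monoʳ g {R' = suc R'} R≤R' with m≤n⇒m<n∨m≡n R≤R'
... | inj₁ R<R' = ≤-trans (rangeSum-monoʳ g (s≤s⁻¹ R<R')) (m≤m+n _ _)
... | inj₂ refl = ≤-refl

∑-rangeSum : ∀ {m} R (h : Fin m → ℕ → ℕ) →
  ∑[ v < m ] rangeSum R (h v) ≡ rangeSum R (λ i → ∑[ v < m ] h v i)
∑-rangeSum zero    h = refl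
∑-rangeSum (suc R) h = trans (∑-distrib-+ (λ v → rangeSum R (h v)) (λ v → h v (suc R)))
                             (cong (_+ ∑[ v < _ ] h v (suc R)) (∑-rangeSum R h))

rangeSum-δ≡0 : ∀ R a → R < a → rangeSum R (λ i → bit (a ≡ᵇ i)) ≡ 0
rangeSum-δ≡0 zero    a 0<a = bit-≡ᵇ a 0 (≢-sym (<⇒≢ 0<a))
rangeSum-δ≡0 (suc R) a R<a =
  cong₂ _+_ (rangeSum-δ≡0 R a (<-trans (n<1+n R) R<a)) (bit-≡ᵇ a (suc R) (≢-sym (<⇒≢ R<a)))

rangeSum-δ≤1 : ∀ R a → rangeSum R (λ i → bit (a ≡ᵇ i)) ≤ 1
rangeSum-δ≤1 zero    a = bit≤1 (a ≡ᵇ 0)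
rangeSum-δ≤1 (suc R) a with a ≟ suc R
... | yes refl = +-mono-≤ (≤-reflexive (rangeSum-δ≡0 R a (n<1+n R))) (bit≤1 (a ≡ᵇ a))
... | no  a≢R  = +-mono-≤ (rangeSum-δ≤1 R a) (≤-reflexive (bit-≡ᵇ a (suc R) a≢R))

rangeSum-δ≥1 : ∀ R a → a ≤ R → 1 ≤ rangeSum R (λ i → bit (a ≡ᵇ i))
rangeSum-δ≥1 zero    zero    _   = ≤-refl
rangeSum-δ≥1 (suc R) a       a≤R with a ≟ suc R
... | yes refl = ≤-trans (≤-reflexive (sym (bit-≡ᵇ-refl a))) (m≤n+m _ _)
... | no  a≢R  = ≤-trans (rangeSum-δ≥1 R a (s≤s⁻¹ (≤∧≢⇒< a≤R a≢R))) (m≤m+n _ _)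

-- The Moore-type level bounds

-- The number of parents of a vertex on level d of a tree (the root has none).
parents : ℕ → ℕ
parents zero    = 0
parents (suc _) = 1

branching : ℕ → ℕ → ℕ
branching k d = k ∸ parents d

-- The size of level i of a tree all of whose vertices on levels < i have degree k.
levelBound : ℕ → ℕ → ℕ
levelBound k zero    = 1
levelBound k (suc i) = levelBound k i * branching k i

module _ {a} {A : Set a} where

  lookup-∷ʳ-last : ∀ {m} (xs : Vec A m) w → lookup (xs ∷ʳ w) (fromℕ m) ≡ w
  lookup-∷ʳ-last []       w = refl
  lookup-∷ʳ-last (x ∷ xs) w = lookup-∷ʳ-last xs w

  all-∷ʳ : ∀ {p} {P : A → Set p} {m} {xs : Vec A m} {w} → All P xs → P w → All P (xs ∷ʳ w)
  all-∷ʳ []         pw = pw ∷ []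
  all-∷ʳ (px ∷ pxs) pw = px ∷ all-∷ʳ pxs pw

  unique-∷ʳ : ∀ {m} {xs : Vec A m} {w} → Unique xs → All (_≢ w) xs → Unique (xs ∷ʳ w)
  unique-∷ʳ []           []             = [] ∷ []
  unique-∷ʳ (x∉xs ∷ xs!) (x≢w ∷ xs≢w)  = all-∷ʳ x∉xs x≢w ∷ unique-∷ʳ xs! xs≢w

  module _ {r} {R : A → A → Set r} where

    linked-∷ʳ : ∀ {m} (xs : Vec A m) {y z} → Linked R (xs ∷ʳ y) → R y z → Linked R ((xs ∷ʳ y) ∷ʳ z)
    linked-∷ʳ []           [-]       yRz = yRz ∷ [-]
    linked-∷ʳ (x ∷ [])     (r ∷ rs)  yRz = r ∷ linked-∷ʳ [] rs yRz
    linked-∷ʳ (x ∷ y ∷ xs) (r ∷ rs)  yRz = r ∷ linked-∷ʳ (y ∷ xs) rs yRz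

    linked-lookup : ∀ {m} {xs : Vec A (suc m)} → Linked R xs →
      ∀ i → R (lookup xs (inject₁ i)) (lookup xs (fsuc i))
    linked-lookup {xs = x ∷ y ∷ xs} (r ∷ rs) fzero    = r
    linked-lookup {xs = x ∷ y ∷ xs} (r ∷ rs) (fsuc i) = linked-lookup rs i

module Walks {n : ℕ} (G : Graph n) where

  adj-sym : ∀ {u v} → Adj G u v → Adj G v u
  adj-sym {u} {v} = subst T (Graph.sym G u v)

  adj-irrefl : ∀ {u} → ¬ Adj G u u
  adj-irrefl {u} = subst T (Graph.irrefl G u)

  snoc : ∀ {u v w l} → Walk G u v l → Adj G v w → Walk G u w (suc l)
  snoc []       vw = vw ∷ []
  snoc (a ∷ p)  vw = a ∷ snoc p vw

  reverse : ∀ {u v l} → Walk G u v l → Walk G v u l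
  reverse []      = []
  reverse (a ∷ p) = snoc (reverse p) (adj-sym a)

  unsnoc : ∀ {u w l} → Walk G u w (suc l) → Σ (Fin n) λ v → Walk G u v l × Adj G v w
  unsnoc (a ∷ [])      = _ , [] , a
  unsnoc (a ∷ (b ∷ p)) with unsnoc (b ∷ p)
  ... | v , q , c = v , a ∷ q , c

  empty-walk : ∀ {u v} → Walk G u v 0 → u ≡ v
  empty-walk [] = refl

  dist-sym : ∀ {u v d} → Dist G u v d → Dist G v u d
  dist-sym (p , shortest) = reverse p , λ l q → shortest l (reverse q)

  dist-unique : ∀ {u v d d'} → Dist G u v d → Dist G u v d' → d ≡ d'
  dist-unique (p , shortest) (p' , shortest') = ≤-antisym (shortest _ p') (shortest' _ p)

  cycle : ∀ u w {l} (inner : Vec (Fin n) (suc l)) →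
    Linked (Adj G) (u ∷ (inner ∷ʳ w)) → Unique (u ∷ (inner ∷ʳ w)) → Adj G w u → Cycle G
  cycle u w {l} inner linked unique w~u = record
    { m        = l
    ; verts    = u ∷ (inner ∷ʳ w)
    ; distinct = λ {i} {j} → lookup-injective unique i j
    ; consec   = linked-lookup linked
    ; closing  = subst (λ z → Adj G z u) (sym (lookup-∷ʳ-last inner w)) w~u
    }

-- The levels of a graph around a root x

module Levels {n : ℕ} (G : Graph n) (x : Fin n) (D : Fin n → ℕ)
              (D-dist : ∀ v → Dist G x v (D v)) where
  open Walks G

  adj-level : ∀ {u v} → Adj G u v → D v ≤ suc (D u)
  adj-level {u} {v} u~v = proj₂ (D-dist v) _ (snoc (proj₁ (D-dist u)) u~v)

  root-level : D x ≡ 0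
  root-level = n≤0⇒n≡0 (proj₂ (D-dist x) 0 [])

  level0-root : ∀ {v} → D v ≡ 0 → v ≡ x
  level0-root {v} Dv≡0 = sym (empty-walk (subst (Walk G x v) Dv≡0 (proj₁ (D-dist v))))

  parent : ∀ {v d} → D v ≡ suc d → Σ (Fin n) λ p → Adj G p v × D p ≡ d
  parent {v} {d} Dv≡d+1 with unsnoc (subst (Walk G x v) Dv≡d+1 (proj₁ (D-dist v)))
  ... | p , walk , p~v = p , p~v ,
        ≤-antisym (proj₂ (D-dist p) d walk) (s≤s⁻¹ (subst (_≤ suc (D p)) Dv≡d+1 (adj-level p~v)))

  higher≢lower : ∀ {a b d} → D a ≡ suc d → D b ≤ d → a ≢ b
  higher≢lower {d = d} Da≡d+1 Db≤d refl = 1+n≰n (subst (_≤ d) Da≡d+1 Db≤d)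

  module Acyclic-levels (acyclic : Acyclic G) where

    record LowPath (d : ℕ) (u w : Fin n) : Set where
      field
        len    : ℕ
        inner  : Vec (Fin n) (suc len)
        linked : Linked (Adj G) (u ∷ (inner ∷ʳ w))
        unique : Unique (u ∷ (inner ∷ʳ w))
        low    : All (λ z → D z ≤ d) (u ∷ (inner ∷ʳ w))
    open LowPath

    -- Two distinct vertices of the same level are joined through their ancestors.
    low-path : ∀ d u w → D u ≡ d → D w ≡ d → u ≢ w → LowPath d u w
    low-path zero    u w Du≡0 Dw≡0 u≢w = ⊥-elim (u≢w (trans (level0-root Du≡0) (sym (level0-root Dw≡0))))
    low-path (suc d) u w Du Dw u≢w with parent Du | parent Dw
    ... | pu , pu~u , Dpu | pw , pw~w , Dpw with pu ≟ᶠ pw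
    ... | yes refl = record
      { len    = 0
      ; inner  = pu ∷ []
      ; linked = adj-sym pu~u ∷ pw~w ∷ [-]
      ; unique = (higher≢lower Du (≤-reflexive Dpu) ∷ u≢w ∷ [])
               ∷ (≢-sym (higher≢lower Dw (≤-reflexive Dpu)) ∷ []) ∷ [] ∷ []
      ; low    = ≤-reflexive Du ∷ m≤n⇒m≤1+n (≤-reflexive Dpu) ∷ ≤-reflexive Dw ∷ []
      }
    ... | no pu≢pw = record
      { len    = suc (suc (len P))
      ; inner  = pu ∷ (inner P ∷ʳ pw)
      ; linked = adj-sym pu~u ∷ linked-∷ʳ (pu ∷ inner P) (linked P) pw~w
      ; unique = all-∷ʳ (All.map (higher≢lower Du) (low P)) u≢w
               ∷ unique-∷ʳ (unique P) (All.map (≢-sym ∘ higher≢lower Dw) (low P))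
      ; low    = ≤-reflexive Du ∷ all-∷ʳ (All.map m≤n⇒m≤1+n (low P)) (≤-reflexive Dw)
      }
      where P = low-path d pu pw Dpu Dpw pu≢pw

    -- No edge joins two vertices of the same level: it would close the low path.
    no-level-edge : ∀ {u w} → Adj G u w → D u ≡ D w → ⊥
    no-level-edge {u} {w} u~w Du≡Dw with u ≟ᶠ w
    ... | yes refl = adj-irrefl u~w
    ... | no u≢w   = acyclic (cycle u w (inner P) (linked P) (unique P) (adj-sym u~w))
      where P = low-path (D u) u w refl (sym Du≡Dw) u≢w

    -- Two parents of v would close a cycle through v and the low path between them.
    unique-parent : ∀ {a b v d} → Adj G a v → Adj G b v → D a ≡ d → D b ≡ d → D v ≡ suc d → a ≡ b
    unique-parent {a} {b} {v} a~v b~v Da Db Dv with a ≟ᶠ b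
    ... | yes a≡b = a≡b
    ... | no a≢b  = ⊥-elim (acyclic (cycle v b (a ∷ inner P) (adj-sym a~v ∷ linked P)
                                            (All.map (higher≢lower Dv) (low P) ∷ unique P) b~v))
      where P = low-path _ a b Da Db a≢b

  -- Counting vertices level by level

  edge : Fin n → Fin n → ℕ
  edge u v = bit (adj G u v)

  deg-∑ : ∀ u → deg G u ≡ ∑[ v < n ] edge u v
  deg-∑ u = trans (cong List.sum (map-tabulate id (edge u))) (listSum-tabulate (edge u))

  atLevel : ℕ → Fin n → ℕ
  atLevel d v = bit (D v ≡ᵇ d)

  atLevel-≡ : ∀ {v d} → D v ≡ d → atLevel d v ≡ 1
  atLevel-≡ {v} {d} Dv≡d = bit-true (≡⇒≡ᵇ (D v) d Dv≡d)

  count : ℕ → ℕ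
  count d = ∑[ v < n ] atLevel d v

  nbrs : Fin n → (Fin n → ℕ) → ℕ
  nbrs u g = ∑[ v < n ] (edge u v * g v)

  below : ℕ → Fin n → ℕ
  below d u = nbrs u (λ v → bit (suc (D v) ≡ᵇ d))

  same : ℕ → Fin n → ℕ
  same d u = nbrs u (atLevel d)

  above : ℕ → Fin n → ℕ
  above d u = nbrs u (atLevel (suc d))

  deg-split : ∀ {u d} → D u ≡ d → deg G u ≡ below d u + same d u + above d u
  deg-split {u} {d} Du≡d = begin
    deg G u                                        ≡⟨ deg-∑ u ⟩
    ∑[ v < n ] edge u v                            ≡⟨ sum-cong-≗ split ⟩
    ∑[ v < n ] (edge u v * lower v + edge u v * atLevel d v + edge u v * atLevel (suc d) v)
                                                   ≡⟨ ∑-distrib-+ {n} _ _ ⟩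
    ∑[ v < n ] (edge u v * lower v + edge u v * atLevel d v) + above d u
                                                   ≡⟨ cong (_+ above d u) (∑-distrib-+ {n} _ _) ⟩
    below d u + same d u + above d u               ∎
    where
    open ≡-Reasoning
    lower : Fin n → ℕ
    lower v = bit (suc (D v) ≡ᵇ d)
    levels : ∀ v → edge u v ≡ edge u v * (lower v + atLevel d v + atLevel (suc d) v)
    levels v with adj G u v in u~v
    ... | false = refl
    ... | true  = sym (trans (+-identityʳ _) (one-of-three (D v) d
                    (subst (λ z → D v ≤ suc z) Du≡d (adj-level adjacent))
                    (subst (_≤ suc (D v)) Du≡d (adj-level (adj-sym adjacent)))))
      where adjacent = subst T (sym u~v) tt
    split : ∀ v → edge u v ≡ edge u v * lower v + edge u v * atLevel d v + edge u v * atLevel (suc d) v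
    split v = trans (levels v) (trans (*-distribˡ-+ (edge u v) _ _)
                (cong (_+ edge u v * atLevel (suc d) v) (*-distribˡ-+ (edge u v) _ _)))

  parents≤below : ∀ {u d} → D u ≡ d → parents d ≤ below d u
  parents≤below {u} {zero}  _  = z≤n
  parents≤below {u} {suc d} Du with parent Du
  ... | p , p~u , Dp = ≤-trans (≤-reflexive (sym (cong₂ _*_ (bit-true (adj-sym p~u)) (atLevel-≡ Dp))))
                               (term≤∑ (λ v → edge u v * atLevel d v) p)

  above≤branching : ∀ {k u d} → deg G u ≤ k → D u ≡ d → above d u ≤ branching k d
  above≤branching {k} {u} {d} deg≤k Du≡d = m+n≤o⇒m≤o∸n (above d u) (begin
    above d u + parents d             ≤⟨ +-monoʳ-≤ (above d u) (parents≤below Du≡d) ⟩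
    above d u + below d u             ≡⟨ +-comm (above d u) (below d u) ⟩
    below d u + above d u             ≤⟨ +-monoˡ-≤ (above d u) (m≤m+n (below d u) (same d u)) ⟩
    below d u + same d u + above d u  ≡⟨ sym (deg-split Du≡d) ⟩
    deg G u                           ≤⟨ deg≤k ⟩
    k                                 ∎)
    where open ≤-Reasoning

  -- Both sides count the edges between level d and level d + 1.
  edges-between : ∀ d → ∑[ u < n ] (atLevel d u * above d u)
                      ≡ ∑[ v < n ] (atLevel (suc d) v * below (suc d) v)
  edges-between d = begin
    ∑[ u < n ] (atLevel d u * above d u)
      ≡⟨ sum-cong-≗ (λ u → *-distribˡ-sum {n} (atLevel d u) _) ⟩
    ∑[ u < n ] ∑[ v < n ] (atLevel d u * (edge u v * atLevel (suc d) v))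
      ≡⟨ ∑-comm {n} {n} _ ⟩
    ∑[ v < n ] ∑[ u < n ] (atLevel d u * (edge u v * atLevel (suc d) v))
      ≡⟨ sum-cong-≗ (λ v → sum-cong-≗ (λ u → flip u v)) ⟩
    ∑[ v < n ] ∑[ u < n ] (atLevel (suc d) v * (edge v u * atLevel d u))
      ≡⟨ sym (sum-cong-≗ (λ v → *-distribˡ-sum {n} (atLevel (suc d) v) _)) ⟩
    ∑[ v < n ] (atLevel (suc d) v * below (suc d) v)  ∎
    where
    open ≡-Reasoning
    flip : ∀ u v → atLevel d u * (edge u v * atLevel (suc d) v)
                 ≡ atLevel (suc d) v * (edge v u * atLevel d u)
    flip u v = begin
      a * (edge u v * b)  ≡⟨ *-comm a _ ⟩
      edge u v * b * a    ≡⟨ cong (λ e → e * b * a) (cong bit (Graph.sym G u v)) ⟩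
      edge v u * b * a    ≡⟨ cong (_* a) (*-comm (edge v u) b) ⟩
      b * edge v u * a    ≡⟨ *-assoc b (edge v u) a ⟩
      b * (edge v u * a)  ∎
      where a = atLevel d u
            b = atLevel (suc d) v

  count-step≤ : ∀ {k} → (∀ u → deg G u ≤ k) → ∀ d → count (suc d) ≤ count d * branching k d
  count-step≤ {k} deg≤k d = begin
    count (suc d)                                    ≡⟨ sum-cong-≗ {n} (λ v → sym (*-identityʳ _)) ⟩
    ∑[ v < n ] (atLevel (suc d) v * 1)                 ≤⟨ ∑-mono (λ v → bit*-mono (D v ≡ᵇ suc d)
                                                          (parents≤below ∘ ≡ᵇ⇒≡ (D v) (suc d))) ⟩
    ∑[ v < n ] (atLevel (suc d) v * below (suc d) v)   ≡⟨ sym (edges-between d) ⟩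
    ∑[ u < n ] (atLevel d u * above d u)               ≤⟨ ∑-mono (λ u → bit*-mono (D u ≡ᵇ d)
                                                          (above≤branching (deg≤k u) ∘ ≡ᵇ⇒≡ (D u) d)) ⟩
    ∑[ u < n ] (atLevel d u * branching k d)           ≡⟨ sym (*-distribʳ-sum (branching k d) (atLevel d)) ⟩
    count d * branching k d                          ∎
    where open ≤-Reasoning

  count-root : count 0 ≡ 1
  count-root = trans (∑-supported (atLevel 0) x off-root) (atLevel-≡ root-level)
    where
    off-root : ∀ v → v ≢ x → atLevel 0 v ≡ 0
    off-root v v≢x = bit-≡ᵇ (D v) 0 (v≢x ∘ level0-root)

  count≤levelBound : ∀ {k} → (∀ u → deg G u ≤ k) → ∀ i → count i ≤ levelBound k i
  count≤levelBound deg≤k zero = ≤-reflexive count-root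
  count≤levelBound {k} deg≤k (suc i) =
    ≤-trans (count-step≤ deg≤k i) (*-monoˡ-≤ (branching k i) (count≤levelBound deg≤k i))

  -- Each vertex lies on exactly one level, so the levels 0 … R cover all
  -- ∑[ v < n ] 1 = n vertices when every vertex is within distance R.
  order≤ : ∀ {R} → (∀ v → D v ≤ R) → ∑[ v < n ] 1 ≤ rangeSum R count
  order≤ {R} within = begin
    ∑[ v < n ] 1                                      ≤⟨ ∑-mono (λ v → rangeSum-δ≥1 R (D v) (within v)) ⟩
    ∑[ v < n ] rangeSum R (λ i → bit (D v ≡ᵇ i))      ≡⟨ ∑-rangeSum {n} R _ ⟩
    rangeSum R count                                  ∎
    where open ≤-Reasoning

  -- Conversely the levels 0 … R are disjoint, so together they have at most n vertices.
  ≤order : ∀ R → rangeSum R count ≤ ∑[ v < n ] 1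
  ≤order R = begin
    rangeSum R count                                  ≡⟨ ∑-rangeSum {n} R _ ⟨
    ∑[ v < n ] rangeSum R (λ i → bit (D v ≡ᵇ i))      ≤⟨ ∑-mono (λ v → rangeSum-δ≤1 R (D v)) ⟩
    ∑[ v < n ] 1                                      ∎
    where open ≤-Reasoning

  module Acyclic-counting (acyclic : Acyclic G) where
    open Acyclic-levels acyclic

    same≡0 : ∀ {u d} → D u ≡ d → same d u ≡ 0
    same≡0 {u} Du≡d = ∑-zero _ λ v → bit*bit≡0 (adj G u v) _ λ u~v onLevel →
      no-level-edge u~v (trans Du≡d (sym (≡ᵇ⇒≡ (D v) _ onLevel)))

    below≤parents : ∀ {u d} → D u ≡ d → below d u ≤ parents d
    below≤parents {u} {zero}  _  = ≤-reflexive (∑-zero _ (λ v → *-zeroʳ (edge u v)))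
    below≤parents {u} {suc d} Du with parent Du
    ... | p , p~u , Dp = begin
      below (suc d) u          ≡⟨ ∑-supported _ p not-parent ⟩
      edge u p * atLevel d p   ≤⟨ *-mono-≤ (bit≤1 (adj G u p)) (bit≤1 (D p ≡ᵇ d)) ⟩
      1                        ∎
      where
      open ≤-Reasoning
      not-parent : ∀ v → v ≢ p → edge u v * atLevel d v ≡ 0
      not-parent v v≢p = bit*bit≡0 (adj G u v) _ λ u~v onLevel →
        v≢p (unique-parent (adj-sym u~v) p~u (≡ᵇ⇒≡ (D v) d onLevel) Dp Du)

    branching≤above : ∀ {k u d} → deg G u ≡ k → D u ≡ d → branching k d ≤ above d u
    branching≤above {k} {u} {d} deg≡k Du≡d = m≤n+o⇒m∸n≤o k (parents d) (begin
      k                                 ≡⟨ trans (sym deg≡k) (deg-split Du≡d) ⟩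
      below d u + same d u + above d u  ≡⟨ cong (λ s → below d u + s + above d u) (same≡0 Du≡d) ⟩
      below d u + 0 + above d u         ≤⟨ +-monoˡ-≤ (above d u) (≤-trans (≤-reflexive (+-identityʳ _))
                                                                           (below≤parents Du≡d)) ⟩
      parents d + above d u             ∎)
      where open ≤-Reasoning

    count-step≥ : ∀ {k d} → (∀ u → D u ≡ d → deg G u ≡ k) → count d * branching k d ≤ count (suc d)
    count-step≥ {k} {d} full = begin
      count d * branching k d                          ≡⟨ *-distribʳ-sum (branching k d) (atLevel d) ⟩
      ∑[ u < n ] (atLevel d u * branching k d)         ≤⟨ ∑-mono (λ u → bit*-mono (D u ≡ᵇ d) λ onLevel →
                                                            let Du≡d = ≡ᵇ⇒≡ (D u) d onLevel
                                                            in branching≤above (full u Du≡d) Du≡d) ⟩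
      ∑[ u < n ] (atLevel d u * above d u)             ≡⟨ edges-between d ⟩
      ∑[ v < n ] (atLevel (suc d) v * below (suc d) v) ≤⟨ ∑-mono (λ v → bit*-mono (D v ≡ᵇ suc d)
                                                            (below≤parents ∘ ≡ᵇ⇒≡ (D v) (suc d))) ⟩
      ∑[ v < n ] (atLevel (suc d) v * 1)               ≡⟨ sum-cong-≗ {n} (λ v → *-identityʳ _) ⟩
      count (suc d)                                    ∎
      where open ≤-Reasoning

    levelBound≤count : ∀ {k e} → (∀ u → suc (D u) < e → deg G u ≡ k) →
      ∀ i → i < e → levelBound k i ≤ count i
    levelBound≤count full zero _ = ≤-reflexive (sym count-root)
    levelBound≤count {k} full (suc i) i+1<e =
      ≤-trans (*-monoˡ-≤ (branching k i) (levelBound≤count full i (<-trans (n<1+n i) i+1<e)))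
              (count-step≥ λ u Du≡i → full u (subst (λ j → suc j < _) (sym Du≡i) i+1<e))

-- If r < e, then the levels 0 … r
-- of G (all n vertices) fit into the Moore bound, which the levels 0 … e − 1
-- of B already fill, leaving no room for y; hence e ≤ r.
ecc≤radius : ∀ {n k r e} (G B : Graph n) {c x y : Fin n} (DG DB : Fin n → ℕ) →
  (∀ v → Dist G c v (DG v)) → (∀ v → DG v ≤ r) → (∀ v → deg G v ≤ k) →
  Acyclic B → (∀ v → Dist B x v (DB v)) → DB y ≡ e →
  (∀ v → suc (DB v) < e → deg B v ≡ k) → e ≤ r
ecc≤radius {e = zero} _ _ _ _ _ _ _ _ _ _ _ = z≤n
ecc≤radius {n} {k} {r} {suc e} G B {y = y} DG DB G-dist within deg≤k acyclic B-dist DBy≡e+1 full =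
  ≮⇒≥ λ r<e+1 → <-irrefl refl (too-many (s≤s⁻¹ r<e+1))
  where
  module LG = Levels G _ DG G-dist
  module LB = Levels B _ DB B-dist
  open LB.Acyclic-counting acyclic using (levelBound≤count)

  top-level-occupied : 0 < LB.count (suc e)
  top-level-occupied = ≤-trans (≤-reflexive (sym (LB.atLevel-≡ DBy≡e+1))) (term≤∑ (LB.atLevel (suc e)) y)

  too-many : r ≤ e → ∑[ v < n ] 1 < ∑[ v < n ] 1
  too-many r≤e = begin-strict
    ∑[ v < n ] 1                ≤⟨ LG.order≤ within ⟩
    rangeSum r LG.count         ≤⟨ rangeSum-mono r (λ i _ → LG.count≤levelBound deg≤k i) ⟩
    rangeSum r (levelBound k)   ≤⟨ rangeSum-monoʳ (levelBound k) r≤e ⟩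
    rangeSum e (levelBound k)   ≤⟨ rangeSum-mono e (λ i i≤e → levelBound≤count full i (s≤s i≤e)) ⟩
    rangeSum e LB.count         <⟨ m<m+n _ top-level-occupied ⟩
    rangeSum (suc e) LB.count   ≤⟨ LB.≤order (suc e) ⟩
    ∑[ v < n ] 1                ∎
    where open ≤-Reasoning

theorem1 : ∀ (n k : ℕ) (T B : Graph n) →
    IsTree T → MaxDegree T k → KBalanced B k →
    ∀ (rB rT : ℕ) → Rad B rB → Rad T rT → rB ≤ rT
theorem1 n k T B _ (deg≤k , _) ((_ , acyclic) , _ , x , e , ecc-x , balanced)
         rB rT (_ , rB-least) ((c , (within-c , _)) , _) =
  ≤-trans (rB-least x e ecc-x)
          (ecc≤radius T B DT DB DT-dist DT≤rT deg≤k acyclic DB-dist DBy≡e full)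
  where
  open Walks B using (dist-sym; dist-unique)

  DT : Fin n → ℕ
  DT v = proj₁ (within-c v)
  DT-dist : ∀ v → Dist T c v (DT v)
  DT-dist v = proj₁ (proj₂ (within-c v))
  DT≤rT : ∀ v → DT v ≤ rT
  DT≤rT v = proj₂ (proj₂ (within-c v))

  DB : Fin n → ℕ
  DB v = proj₁ (proj₁ ecc-x v)
  DB-dist : ∀ v → Dist B x v (DB v)
  DB-dist v = proj₁ (proj₂ (proj₁ ecc-x v))

  DBy≡e : DB (proj₁ (proj₂ ecc-x)) ≡ e
  DBy≡e = dist-unique (DB-dist _) (proj₂ (proj₂ ecc-x))

  full : ∀ v → suc (DB v) < e → deg B v ≡ k
  full v DBv+2≤e = balanced v (DB v) (dist-sym (DB-dist v)) (subst (_≤ e) (+-comm 2 (DB v)) DBv+2≤e)
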